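{- Let $G$ be a finite group of order $n$. If $G$ contains pairwise distinct elements $u_1,u_2,u_3,u_4$ such that $u_i$ and $u_{i+1}$ are nonadjacent in $\Gamma_G$ for each $1\le i\le 3$, then $\lambda(\Gamma_G)\le 2n-5$.
   Context: The (undirected) power graph $\Gamma_G$ of a finite group $G$ has vertex set $G$, two distinct elements being adjacent if one is a power of the other. An $L(2,1)$-labeling of a graph $\Gamma$ is a function $f:V(\Gamma)\to\mathbb{Z}_{\ge 0}$ such that $|f(u)-f(v)|\ge 2$ for adjacent $u,v$ and $|f(u)-f(v)|\ge 1$ for $u,v$ at distance two; its span is $\max f-\min f$, and $\lambda(\Gamma)$ is the minimum span over all $L(2,1)$-labelings of $\Gamma$. -}

module Defs where

open import Level using (Level)
open import Algebra.Bundles using (Group)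
open import Data.Nat using (ℕ; zero; suc; _+_; _≤_)
open import Data.Fin using (Fin)
open import Data.Product using (Σ; _×_; ∃)
open import Data.Sum using (_⊎_)
open import Relation.Nullary using (¬_)
open import Relation.Binary.PropositionalEquality using (_≡_)
import Relation.Binary.PropositionalEquality as ≡
open import Function.Bundles using (Bijection)

module PowerGraph {c ℓ : Level} (G : Group c ℓ) where
  open Group G

  _^_ : Carrier → ℕ → Carrier
  x ^ zero  = ε
  x ^ suc k = x ∙ (x ^ k)

  IsPowerOf : Carrier → Carrier → Set ℓ
  IsPowerOf y x = ∃ λ k → y ≈ (x ^ k)

  Adj : Carrier → Carrier → Set ℓ
  Adj u v = ¬ (u ≈ v) × (IsPowerOf u v ⊎ IsPowerOf v u)

  Dist2 : Carrier → Carrier → Set (c Level.⊔ ℓ)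
  Dist2 u v = ¬ (u ≈ v) × ¬ Adj u v × (∃ λ w → Adj u w × Adj w v)

  record L21Labeling : Set (c Level.⊔ ℓ) where
    field
      f      : Carrier → ℕ
      f-cong : ∀ {x y} → x ≈ y → f x ≡ f y
      adj    : ∀ u v → Adj u v → (f u + 2 ≤ f v) ⊎ (f v + 2 ≤ f u)
      dist2  : ∀ u v → Dist2 u v → ¬ (f u ≡ f v)

  SpanAtMost : L21Labeling → ℕ → Set c
  SpanAtMost L k = ∀ x y → L21Labeling.f L x ≤ L21Labeling.f L y + k

  -- λ(Γ_G) ≤ k  (λ is the minimum span over all L(2,1)-labelings)
  λ≤ : ℕ → Set (c Level.⊔ ℓ)
  λ≤ k = Σ L21Labeling λ L → SpanAtMost L k

HasOrder : {c ℓ : Level} → Group c ℓ → ℕ → Set (c Level.⊔ ℓ)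
HasOrder G n = Bijection (≡.setoid (Fin n)) (Group.setoid G)

-- Enumerate G as positions 0, …, n−1 with u₁, u₂, u₃, u₄ at positions 0, 1, 2, 3, and label
-- position k by k + (k ∸ 3), i.e. 0, 1, 2, 3, 5, 7, …, 2n−5.  The labeling is injective, so the
-- distance-two condition is automatic, and two positions get labels at least 2 apart unless they
-- are consecutive among 0, …, 3; those hold exactly the nonadjacent pairs uᵢ, uᵢ₊₁.
module Submission where

open import Defs
open import Level using (Level; _⊔_)
open import Algebra.Bundles using (Group)
open import Data.Nat using (ℕ; zero; suc; _+_; _*_; _∸_; _≤_; _<_; s≤s)
open import Data.Nat.Properties
open import Data.Fin as Fin using (Fin; toℕ; fromℕ; fromℕ<; inject₁)
open import Data.Fin.Properties
  using (toℕ-injective; toℕ<n; toℕ-fromℕ; toℕ-fromℕ<; toℕ-inject₁; inject₁-injective; fromℕ≢inject₁)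
open import Data.Fin.Patterns using (0F; 1F; 2F; 3F)
open import Data.Fin.Relation.Unary.Top using (view; ‵fromℕ; ‵inject₁)
open import Data.Product using (Σ-syntax; _,_; proj₁)
open import Data.Sum as Sum using (_⊎_; inj₁; inj₂)
open import Function using (_∘_)
open import Function.Bundles using (Bijection; Injection)
open import Function.Definitions using (Congruent; Injective)
open import Function.Properties.Bijection using (Bijection⇒Inverse)
open import Function.Properties.Inverse using (Inverse⇒Injection)
import Function.Construct.Symmetry as Symmetry
open import Relation.Nullary using (¬_; yes; no; contradiction)
open import Relation.Binary.Bundles using (Setoid)
open import Relation.Binary.Definitions using (tri<; tri≈; tri>)
open import Relation.Binary.PropositionalEquality
  using (_≡_; _≢_; refl; sym; trans; cong; module ≡-Reasoning)
import Relation.Binary.PropositionalEquality as ≡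

transpose : ℕ → ℕ → ℕ → ℕ
transpose i j k with k ≟ i
... | yes _ = j
... | no _ with k ≟ j
...   | yes _ = i
...   | no _  = k

transpose-fixes : ∀ i j {k} → k ≢ i → k ≢ j → transpose i j k ≡ k
transpose-fixes i j {k} k≢i k≢j with k ≟ i
... | yes k≡i = contradiction k≡i k≢i
... | no _ with k ≟ j
...   | yes k≡j = contradiction k≡j k≢j
...   | no _    = refl

transpose-sendsʳ : ∀ i j → transpose i j j ≡ i
transpose-sendsʳ i j with j ≟ i
... | yes j≡i = j≡i
... | no _ with j ≟ j
...   | yes _   = refl
...   | no j≢j  = contradiction refl j≢j

transpose-sendsˡ : ∀ i j → transpose i j i ≡ j
transpose-sendsˡ i j with i ≟ i
... | yes _   = refl
... | no i≢i  = contradiction refl i≢i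

transpose-involutive : ∀ i j k → transpose i j (transpose i j k) ≡ k
transpose-involutive i j k with k ≟ i
... | yes refl = transpose-sendsʳ k j
... | no k≢i with k ≟ j
...   | yes refl = transpose-sendsˡ i k
...   | no k≢j   = transpose-fixes i j k≢i k≢j

transpose-injective : ∀ i j {k l} → transpose i j k ≡ transpose i j l → k ≡ l
transpose-injective i j {k} {l} eq = begin
  k                               ≡⟨ transpose-involutive i j k ⟨
  transpose i j (transpose i j k) ≡⟨ cong (transpose i j) eq ⟩
  transpose i j (transpose i j l) ≡⟨ transpose-involutive i j l ⟩
  l                               ∎
  where open ≡-Reasoning

transpose-< : ∀ {n i j k} → i < n → j < n → k < n → transpose i j k < n
transpose-< {i = i} {j} {k} i<n j<n k<n with k ≟ i
... | yes _ = j<n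
... | no _ with k ≟ j
...   | yes _ = i<n
...   | no _  = k<n

label : ℕ → ℕ → ℕ
label r k = k + (k ∸ r)

label-mono-< : ∀ r {a b} → a < b → label r a < label r b
label-mono-< r a<b = +-mono-<-≤ a<b (∸-monoˡ-≤ r (<⇒≤ a<b))

label-injective : ∀ r {a b} → label r a ≡ label r b → a ≡ b
label-injective r {a} {b} eq with <-cmp a b
... | tri< a<b _ _ = contradiction eq (<⇒≢ (label-mono-< r a<b))
... | tri≈ _ a≡b _ = a≡b
... | tri> _ _ b<a = contradiction (sym eq) (<⇒≢ (label-mono-< r b<a))

label-suc : ∀ {r a} → r ≤ a → label r (suc a) ≡ label r a + 2
label-suc {r} {a} r≤a = begin
  suc a + (suc a ∸ r)   ≡⟨ cong (suc a +_) (+-∸-assoc 1 r≤a) ⟩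
  suc a + suc (a ∸ r)   ≡⟨ cong suc (+-suc a (a ∸ r)) ⟩
  2 + (a + (a ∸ r))     ≡⟨ +-comm 2 (label r a) ⟩
  label r a + 2         ∎
  where open ≡-Reasoning

label-spread : ∀ r {a b} → a < b → (b ≡ suc a → r ≤ a) → label r a + 2 ≤ label r b
label-spread r {a} {b} a<b consecutive⇒r≤a with m≤n⇒m<n∨m≡n a<b
... | inj₁ 2+a≤b = begin
  label r a + 2        ≡⟨ +-comm (label r a) 2 ⟩
  (2 + a) + (a ∸ r)    ≤⟨ +-mono-≤ 2+a≤b (∸-monoˡ-≤ r (≤-trans (n≤1+n a) a<b)) ⟩
  label r b            ∎
  where open ≤-Reasoning
... | inj₂ refl = ≤-reflexive (sym (label-suc (consecutive⇒r≤a refl)))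

label-bound : ∀ {r n k} → r < n → k < n → label r k ≤ 2 * n ∸ (r + 2)
label-bound {r} {suc m} {k} (s≤s r≤m) (s≤s k≤m) = begin
  k + (k ∸ r)                ≤⟨ +-mono-≤ k≤m (∸-monoˡ-≤ r k≤m) ⟩
  m + (m ∸ r)                ≡⟨ +-∸-assoc m r≤m ⟨
  (m + m) ∸ r                ≡⟨ cong (λ x → (m + x) ∸ r) (+-identityʳ m) ⟨
  2 * m ∸ r                  ≡⟨ cong (λ x → (x ∸ 2) ∸ r) (*-suc 2 m) ⟨
  (2 * suc m ∸ 2) ∸ r        ≡⟨ ∸-+-assoc (2 * suc m) 2 r ⟩
  2 * suc m ∸ (2 + r)        ≡⟨ cong (2 * suc m ∸_) (+-comm 2 r) ⟩
  2 * suc m ∸ (r + 2)        ∎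
  where open ≤-Reasoning

module _ {a ℓ} (S : Setoid a ℓ) where
  open Setoid S using (Carrier; _≈_)

  record Coding (n : ℕ) : Set (a ⊔ ℓ) where
    field
      code           : Carrier → ℕ
      code-cong      : Congruent _≈_ _≡_ code
      code-injective : Injective _≈_ _≡_ code
      code<n         : ∀ x → code x < n

  open Coding

  bijection⇒coding : ∀ {n} → Bijection (≡.setoid (Fin n)) S → Coding n
  bijection⇒coding β = record
    { code           = toℕ ∘ to
    ; code-cong      = cong toℕ ∘ to-cong
    ; code-injective = to-injective ∘ toℕ-injective
    ; code<n         = toℕ<n ∘ to
    }
    where
    open Injection (Inverse⇒Injection (Symmetry.inverse (Bijection⇒Inverse β)))
      using (to) renaming (cong to to-cong; injective to to-injective)

  moveTo : ∀ {n i} → i < n → Carrier → Coding n → Coding n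
  moveTo {i = i} i<n x e = record
    { code           = transpose i (code e x) ∘ code e
    ; code-cong      = cong (transpose i (code e x)) ∘ code-cong e
    ; code-injective = code-injective e ∘ transpose-injective i (code e x)
    ; code<n         = λ y → transpose-< i<n (code<n e x) (code<n e y)
    }

  moveTo-moves : ∀ {n i} (i<n : i < n) x e → code (moveTo i<n x e) x ≡ i
  moveTo-moves {i = i} _ x e = transpose-sendsʳ i (code e x)

  moveTo-fixes : ∀ {n i} (i<n : i < n) {x y} e → code e y ≢ i → ¬ y ≈ x →
                 code (moveTo i<n x e) y ≡ code e y
  moveTo-fixes {i = i} _ e y≢i y≉x = transpose-fixes i _ y≢i (y≉x ∘ code-injective e)

  align : ∀ {n} k (v : Fin k → Carrier) → Injective _≡_ _≈_ v → Coding n →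
          Σ[ e ∈ Coding n ] (∀ i → code e (v i) ≡ toℕ i)
  align zero    v v-inj e = e , λ ()
  align {n} (suc k) v v-inj e with align k (v ∘ inject₁) (inject₁-injective ∘ v-inj) e
  ... | e′ , aligned′ = moveTo k<n last e′ , aligned
    where
    last : Carrier
    last = v (fromℕ k)

    k≤code-last : k ≤ code e′ last
    k≤code-last = ≮⇒≥ λ lt → fromℕ≢inject₁ (v-inj (code-injective e′
      (trans (sym (toℕ-fromℕ< lt)) (sym (aligned′ (fromℕ< lt))))))

    k<n : k < n
    k<n = ≤-<-trans k≤code-last (code<n e′ last)

    aligned : ∀ i → code (moveTo k<n last e′) (v i) ≡ toℕ i
    aligned i with view i
    ... | ‵fromℕ     = trans (moveTo-moves k<n last e′) (sym (toℕ-fromℕ k))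
    ... | ‵inject₁ j = begin
      code (moveTo k<n last e′) (v (inject₁ j)) ≡⟨ moveTo-fixes k<n e′ code≢k v≉last ⟩
      code e′ (v (inject₁ j))                  ≡⟨ aligned′ j ⟩
      toℕ j                                    ≡⟨ toℕ-inject₁ j ⟨
      toℕ (inject₁ j)                          ∎
      where
      open ≡-Reasoning
      code≢k : code e′ (v (inject₁ j)) ≢ k
      code≢k eq = <⇒≢ (toℕ<n j) (trans (sym (aligned′ j)) eq)
      v≉last : ¬ v (inject₁ j) ≈ last
      v≉last = fromℕ≢inject₁ ∘ sym ∘ v-inj

module _ {c ℓ} (G : Group c ℓ) where
  open Group G using (Carrier; _≈_; ∙-cong; setoid)
    renaming (refl to ≈-refl; sym to ≈-sym; trans to ≈-trans)
  open PowerGraph G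

  ^-congˡ : ∀ k → Congruent _≈_ _≈_ (_^ k)
  ^-congˡ zero    _   = ≈-refl
  ^-congˡ (suc k) x≈y = ∙-cong x≈y (^-congˡ k x≈y)

  IsPowerOf-cong : ∀ {y x y′ x′} → y ≈ y′ → x ≈ x′ → IsPowerOf y x → IsPowerOf y′ x′
  IsPowerOf-cong y≈y′ x≈x′ (k , y≈xᵏ) = k , ≈-trans (≈-sym y≈y′) (≈-trans y≈xᵏ (^-congˡ k x≈x′))

  Adj-sym : ∀ {u v} → Adj u v → Adj v u
  Adj-sym (u≉v , inj₁ p) = u≉v ∘ ≈-sym , inj₂ p
  Adj-sym (u≉v , inj₂ p) = u≉v ∘ ≈-sym , inj₁ p

  Adj-cong : ∀ {u v u′ v′} → u ≈ u′ → v ≈ v′ → Adj u v → Adj u′ v′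
  Adj-cong {u′ = u′} {v′ = v′} u≈u′ v≈v′ (u≉v , power) =
    u′≉v′ , Sum.map (IsPowerOf-cong u≈u′ v≈v′) (IsPowerOf-cong v≈v′ u≈u′) power
    where
    u′≉v′ : ¬ u′ ≈ v′
    u′≉v′ u′≈v′ = u≉v (≈-trans u≈u′ (≈-trans u′≈v′ (≈-sym v≈v′)))

  λ≤-nonadjacentPath : ∀ {n} → HasOrder G n → ∀ r (v : Fin (suc r) → Carrier) →
                       Injective _≡_ _≈_ v → (∀ i → ¬ Adj (v (inject₁ i)) (v (Fin.suc i))) →
                       λ≤ (2 * n ∸ (r + 2))
  λ≤-nonadjacentPath {n} order r v v-inj v-nonadj
    with align setoid (suc r) v v-inj (bijection⇒coding setoid order)
  ... | e , aligned = labeling , λ x y → ≤-trans (label-bound r<n (code<n x)) (m≤n+m _ _)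
    where
    open Coding e

    on-path : ∀ {x} i → code x ≡ toℕ i → x ≈ v i
    on-path i eq = code-injective (trans eq (sym (aligned i)))

    r<n : r < n
    r<n = ≤-<-trans (≤-reflexive (trans (sym (toℕ-fromℕ r)) (sym (aligned (fromℕ r))))) (code<n _)

    adjacent-consecutive⇒r≤ : ∀ {x y} → Adj x y → code y ≡ suc (code x) → r ≤ code x
    adjacent-consecutive⇒r≤ A eq = ≮⇒≥ λ lt → v-nonadj (fromℕ< lt) (Adj-cong
      (on-path _ (trans (sym (toℕ-fromℕ< lt)) (sym (toℕ-inject₁ _))))
      (on-path _ (trans eq (cong suc (sym (toℕ-fromℕ< lt)))))
      A)

    labeling : L21Labeling
    labeling = record
      { f      = label r ∘ code
      ; f-cong = cong (label r) ∘ code-cong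
      ; adj    = λ _ _ → spread
      ; dist2  = λ _ _ D → proj₁ D ∘ code-injective ∘ label-injective r
      }
      where
      spread : ∀ {x y} → Adj x y →
               label r (code x) + 2 ≤ label r (code y) ⊎ label r (code y) + 2 ≤ label r (code x)
      spread {x} {y} A with <-cmp (code x) (code y)
      ... | tri< lt _ _ = inj₁ (label-spread r lt (adjacent-consecutive⇒r≤ A))
      ... | tri≈ _ eq _ = contradiction (code-injective eq) (proj₁ A)
      ... | tri> _ _ gt = inj₂ (label-spread r gt (adjacent-consecutive⇒r≤ (Adj-sym A)))

lemma4p3 : {c ℓ : Level} (G : Group c ℓ) (n : ℕ) → HasOrder G n →
    let open Group G
        open PowerGraph G
    in (u₁ u₂ u₃ u₄ : Carrier) →
       ¬ (u₁ ≈ u₂) → ¬ (u₁ ≈ u₃) → ¬ (u₁ ≈ u₄) →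
       ¬ (u₂ ≈ u₃) → ¬ (u₂ ≈ u₄) → ¬ (u₃ ≈ u₄) →
       ¬ Adj u₁ u₂ → ¬ Adj u₂ u₃ → ¬ Adj u₃ u₄ →
       λ≤ (2 * n ∸ 5)
lemma4p3 G n order u₁ u₂ u₃ u₄ u₁≉u₂ u₁≉u₃ u₁≉u₄ u₂≉u₃ u₂≉u₄ u₃≉u₄ ¬u₁~u₂ ¬u₂~u₃ ¬u₃~u₄ =
  λ≤-nonadjacentPath G order 3 path path-injective path-nonadjacent
  where
  open Group G using (Carrier; _≈_) renaming (sym to ≈-sym)
  open PowerGraph G using (Adj)

  path : Fin 4 → Carrier
  path 0F = u₁
  path 1F = u₂
  path 2F = u₃
  path 3F = u₄

  path-injective : Injective _≡_ _≈_ path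
  path-injective {0F} {0F} _  = refl
  path-injective {1F} {1F} _  = refl
  path-injective {2F} {2F} _  = refl
  path-injective {3F} {3F} _  = refl
  path-injective {0F} {1F} eq = contradiction eq u₁≉u₂
  path-injective {0F} {2F} eq = contradiction eq u₁≉u₃
  path-injective {0F} {3F} eq = contradiction eq u₁≉u₄
  path-injective {1F} {2F} eq = contradiction eq u₂≉u₃
  path-injective {1F} {3F} eq = contradiction eq u₂≉u₄
  path-injective {2F} {3F} eq = contradiction eq u₃≉u₄
  path-injective {1F} {0F} eq = contradiction (≈-sym eq) u₁≉u₂
  path-injective {2F} {0F} eq = contradiction (≈-sym eq) u₁≉u₃
  path-injective {3F} {0F} eq = contradiction (≈-sym eq) u₁≉u₄
  path-injective {2F} {1F} eq = contradiction (≈-sym eq) u₂≉u₃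
  path-injective {3F} {1F} eq = contradiction (≈-sym eq) u₂≉u₄
  path-injective {3F} {2F} eq = contradiction (≈-sym eq) u₃≉u₄

  path-nonadjacent : ∀ i → ¬ Adj (path (inject₁ i)) (path (Fin.suc i))
  path-nonadjacent 0F = ¬u₁~u₂
  path-nonadjacent 1F = ¬u₂~u₃
  path-nonadjacent 2F = ¬u₃~u₄
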